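{- Let $\overrightarrow{G}$ be a difference distance magic oriented graph with vertex set $\{v_1,\dots,v_n\}$ and difference distance magic labeling $f: V(\overrightarrow{G}) \to \{1,2,\dots,n\}$. Then $\sum_{i=1}^n imb(v_i) f(v_i) = 0$.
   Context: An oriented graph is a digraph with no loops, no multiple arcs, and such that $(u,v)$ being an arc implies $(v,u)$ is not an arc. $N^+(v)$ is the set of $u$ with $(u,v)$ an arc, $N^-(v)$ the set of $u$ with $(v,u)$ an arc; $imb(v)=|N^+(v)|-|N^-(v)|$. For a labeling $f$, the weight of $v$ is $wt_f(v)=\sum_{u\in N^+(v)} f(u) - \sum_{u \in N^-(v)} f(u)$. A difference distance magic (DDM) labeling of an oriented graph on $n$ vertices is a bijection $f: V \to \{1,\dots,n\}$ with $wt_f(v)=0$ for every vertex $v$; an oriented graph admitting one is a difference distance magic oriented graph (DDMOG). -}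

module Defs where

open import Data.Nat using (ℕ; zero; suc)
open import Data.Fin using (Fin; toℕ)
import Data.Fin as F
open import Data.Bool using (Bool; true; false; T)
open import Data.Integer using (ℤ; +_; _+_; _-_; _*_; 0ℤ)
open import Data.Product using (_×_)
open import Relation.Nullary using (¬_)
open import Function.Bundles using (_⤖_; Bijection)
open import Relation.Binary.PropositionalEquality using (_≡_)

sumℤ : (n : ℕ) → (Fin n → ℤ) → ℤ
sumℤ zero    g = 0ℤ
sumℤ (suc n) g = g F.zero + sumℤ n (λ i → g (F.suc i))

record OrientedGraph (n : ℕ) : Set where
  field
    arc      : Fin n → Fin n → Bool
    loopless : ∀ v → ¬ T (arc v v)
    oriented : ∀ u v → T (arc u v) → ¬ T (arc v u)
open OrientedGraph public

indicator : Bool → ℤ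
indicator true  = + 1
indicator false = 0ℤ

-- N⁺(v) = { u | (u,v) arc },  N⁻(v) = { u | (v,u) arc }  (paper's convention)
-- imb(v) = |N⁺(v)| - |N⁻(v)|
imb : {n : ℕ} → OrientedGraph n → Fin n → ℤ
imb {n} G v = sumℤ n (λ u → indicator (arc G u v)) - sumℤ n (λ u → indicator (arc G v u))

wt : {n : ℕ} → OrientedGraph n → (Fin n → ℕ) → Fin n → ℤ
wt {n} G f v =
  sumℤ n (λ u → indicator (arc G u v) * + f u) - sumℤ n (λ u → indicator (arc G v u) * + f u)

-- the label set {1,…,n} is represented by Fin n via i ↦ toℕ i + 1
labelValue : {n : ℕ} → Fin n → ℕ
labelValue i = suc (toℕ i)

labelling : {n : ℕ} → Fin n ⤖ Fin n → Fin n → ℕ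
labelling σ u = labelValue (Bijection.to σ u)

IsDDMLabeling : {n : ℕ} → OrientedGraph n → Fin n ⤖ Fin n → Set
IsDDMLabeling G σ = ∀ v → wt G (labelling σ) v ≡ 0ℤ

-- Write d(u,v) = [u→v] − [v→u] for the signed arc indicator; it is antisymmetric.
-- Then imb(v) = Σ_u d(u,v) and wt(v) = Σ_u d(u,v) f(u), so exchanging the order of
-- summation and swapping the names u, v gives Σ_v imb(v) f(v) = − Σ_v wt(v),
-- which vanishes when every weight does.
module Submission where

open import Defs
open import Data.Nat using (ℕ; zero; suc)
open import Data.Fin using (Fin)
import Data.Fin as F
open import Data.Integer using (ℤ; +_; _*_; 0ℤ; _+_; _-_; -_; -1ℤ)
open import Data.Integer.Properties
  using (+-*-semiring; +-*-ring; +-0-abelianGroup; -1*i≡-i; neg-distribˡ-*)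
open import Algebra.Properties.AbelianGroup +-0-abelianGroup using (⁻¹-anti-homo‿-)
open import Algebra.Properties.Ring +-*-ring using ([y-z]x≈yx-zx)
open import Algebra.Properties.Semiring.Sum +-*-semiring
  using (sum; sum-cong-≗; sum-replicate-zero; ∑-distrib-+; ∑-comm; *-distribˡ-sum; *-distribʳ-sum)
open import Function.Bundles using (_⤖_)
open import Relation.Binary.PropositionalEquality
open ≡-Reasoning

sumℤ≡sum : ∀ n (g : Fin n → ℤ) → sumℤ n g ≡ sum g
sumℤ≡sum zero    g = refl
sumℤ≡sum (suc n) g = cong (_+_ (g F.zero)) (sumℤ≡sum n (λ i → g (F.suc i)))

sum-neg : ∀ {n} (g : Fin n → ℤ) → sum (λ i → - g i) ≡ - sum g
sum-neg g = begin
  sum (λ i → - g i)       ≡⟨ sum-cong-≗ (λ i → sym (-1*i≡-i (g i))) ⟩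
  sum (λ i → -1ℤ * g i)   ≡⟨ *-distribˡ-sum -1ℤ g ⟨
  -1ℤ * sum g             ≡⟨ -1*i≡-i (sum g) ⟩
  - sum g                 ∎

sum-minus : ∀ {n} (g h : Fin n → ℤ) → sum (λ i → g i - h i) ≡ sum g - sum h
sum-minus g h = trans (∑-distrib-+ g (λ i → - h i)) (cong (_+_ (sum g)) (sum-neg h))

sumℤ-minus : ∀ n (g h : Fin n → ℤ) → sumℤ n g - sumℤ n h ≡ sum (λ i → g i - h i)
sumℤ-minus n g h = trans (cong₂ _-_ (sumℤ≡sum n g) (sumℤ≡sum n h)) (sym (sum-minus g h))

∑-antisymmetric : ∀ {n} (d : Fin n → Fin n → ℤ) → (∀ u v → d v u ≡ - d u v) →
                  (h : Fin n → ℤ) →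
                  sum (λ v → sum (λ u → d u v) * h v) ≡ - sum (λ v → sum (λ u → d u v * h u))
∑-antisymmetric d antisym h = begin
  sum (λ v → sum (λ u → d u v) * h v)
    ≡⟨ sum-cong-≗ (λ v → *-distribʳ-sum (h v) (λ u → d u v)) ⟩
  sum (λ v → sum (λ u → d u v * h v))
    ≡⟨ ∑-comm (λ v u → d u v * h v) ⟩
  sum (λ u → sum (λ v → d u v * h v))
    ≡⟨ sum-cong-≗ (λ u → sum-cong-≗ (λ v → flip u v)) ⟩
  sum (λ u → sum (λ v → - (d v u * h v)))
    ≡⟨ sum-cong-≗ (λ u → sum-neg (λ v → d v u * h v)) ⟩
  sum (λ u → - sum (λ v → d v u * h v))
    ≡⟨ sum-neg (λ u → sum (λ v → d v u * h v)) ⟩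
  - sum (λ u → sum (λ v → d v u * h v))
    ∎
  where
  flip : ∀ u v → d u v * h v ≡ - (d v u * h v)
  flip u v = trans (cong (_* h v) (antisym v u)) (sym (neg-distribˡ-* (d v u) (h v)))

signedArc : ∀ {n} → OrientedGraph n → Fin n → Fin n → ℤ
signedArc G u v = indicator (arc G u v) - indicator (arc G v u)

signedArc-antisym : ∀ {n} (G : OrientedGraph n) u v → signedArc G v u ≡ - signedArc G u v
signedArc-antisym G u v = sym (⁻¹-anti-homo‿- (indicator (arc G u v)) (indicator (arc G v u)))

imb≡∑signedArc : ∀ {n} (G : OrientedGraph n) v → imb G v ≡ sum (λ u → signedArc G u v)
imb≡∑signedArc {n} G v =
  sumℤ-minus n (λ u → indicator (arc G u v)) (λ u → indicator (arc G v u))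

wt≡∑signedArc : ∀ {n} (G : OrientedGraph n) (f : Fin n → ℕ) v →
                wt G f v ≡ sum (λ u → signedArc G u v * + f u)
wt≡∑signedArc {n} G f v = trans
  (sumℤ-minus n (λ u → indicator (arc G u v) * + f u) (λ u → indicator (arc G v u) * + f u))
  (sum-cong-≗ (λ u → sym ([y-z]x≈yx-zx (+ f u) (indicator (arc G u v)) (indicator (arc G v u)))))

∑imb*f≡-∑wt : ∀ {n} (G : OrientedGraph n) (f : Fin n → ℕ) →
              sum (λ v → imb G v * + f v) ≡ - sum (wt G f)
∑imb*f≡-∑wt G f = begin
  sum (λ v → imb G v * + f v)
    ≡⟨ sum-cong-≗ (λ v → cong (_* + f v) (imb≡∑signedArc G v)) ⟩
  sum (λ v → sum (λ u → signedArc G u v) * + f v)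
    ≡⟨ ∑-antisymmetric (signedArc G) (signedArc-antisym G) (λ v → + f v) ⟩
  - sum (λ v → sum (λ u → signedArc G u v * + f u))
    ≡⟨ cong -_ (sum-cong-≗ (wt≡∑signedArc G f)) ⟨
  - sum (wt G f)
    ∎

lemma2 : (n : ℕ) (G : OrientedGraph n) (σ : Fin n ⤖ Fin n) →
         IsDDMLabeling G σ →
         sumℤ n (λ v → imb G v * + labelling σ v) ≡ 0ℤ
lemma2 n G σ ddm = begin
  sumℤ n (λ v → imb G v * + labelling σ v)   ≡⟨ sumℤ≡sum n _ ⟩
  sum (λ v → imb G v * + labelling σ v)      ≡⟨ ∑imb*f≡-∑wt G (labelling σ) ⟩
  - sum (wt G (labelling σ))                 ≡⟨ cong -_ (sum-cong-≗ ddm) ⟩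
  - sum {n} (λ _ → 0ℤ)                       ≡⟨ cong -_ (sum-replicate-zero n) ⟩
  0ℤ                                         ∎
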